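{- Let $a$ and $b$ be positive integers. Then there exists a connected graph $G$ such that $rvc(G)=a$ and $srvc(G)=b$ if and only if $a=b\in\{1,2\}$ or $3\le a\le b$.
   Context: All graphs are finite and simple. In a vertex-coloured graph, a path is vertex-rainbow if its internal vertices have pairwise distinct colours. A vertex-colouring of a connected graph $G$ is rainbow vertex-connected if any two vertices are joined by a vertex-rainbow path, and strongly rainbow vertex-connected if any two vertices $u,v$ are joined by a vertex-rainbow $u$–$v$ geodesic (a $u$–$v$ path of length equal to the distance $d(u,v)$). The rainbow vertex-connection number $rvc(G)$ (resp. strong rainbow vertex-connection number $srvc(G)$) is the minimum number of colours in a rainbow vertex-connected (resp. strongly rainbow vertex-connected) vertex-colouring of $G$; by convention these equal $0$ for complete graphs. -}

module Defs where

open import Data.Nat using (ℕ; zero; suc; _≤_)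
open import Data.Fin using (Fin)
open import Data.Bool using (Bool; true; false)
open import Data.List using (List; []; _∷_; map)
open import Data.List.Relation.Unary.Unique.Propositional using (Unique)
open import Data.Product using (Σ; _×_; ∃)
open import Data.Sum using (_⊎_)
open import Relation.Nullary using (¬_)
open import Relation.Binary.PropositionalEquality using (_≡_; _≢_)

record Graph : Set where
  field
    n      : ℕ
    adj    : Fin n → Fin n → Bool
    sym    : ∀ u v → adj u v ≡ adj v u
    irrefl : ∀ u → adj u u ≡ false

open Graph public

Vertex : Graph → Set
Vertex G = Fin (n G)

Adj : (G : Graph) → Vertex G → Vertex G → Set
Adj G u v = adj G u v ≡ true

data Walk (G : Graph) : Vertex G → Vertex G → Set where
  [_]    : (u : Vertex G) → Walk G u u
  _∷⟨_⟩_ : ∀ {v w} (u : Vertex G) → Adj G u v → Walk G v w → Walk G u w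

vertices : ∀ {G u v} → Walk G u v → List (Vertex G)
vertices [ u ] = u ∷ []
vertices (u ∷⟨ _ ⟩ p) = u ∷ vertices p

len : ∀ {G u v} → Walk G u v → ℕ
len [ _ ] = zero
len (_ ∷⟨ _ ⟩ p) = suc (len p)

dropLast : ∀ {G u v} → Walk G u v → List (Vertex G)
dropLast [ _ ] = []
dropLast (u ∷⟨ _ ⟩ p) = u ∷ dropLast p

internal : ∀ {G u v} → Walk G u v → List (Vertex G)
internal [ _ ] = []
internal (_ ∷⟨ _ ⟩ p) = dropLast p

IsPath : ∀ {G u v} → Walk G u v → Set
IsPath p = Unique (vertices p)

IsGeodesic : ∀ {G u v} → Walk G u v → Set
IsGeodesic {G} {u} {v} p = IsPath p × (∀ (q : Walk G u v) → IsPath q → len p ≤ len q)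

Connected : Graph → Set
Connected G = Fin (n G) × (∀ (u v : Vertex G) → Σ (Walk G u v) IsPath)

Complete : Graph → Set
Complete G = ∀ (u v : Vertex G) → u ≢ v → Adj G u v

-- vertex-colourings with (at most) k colours
Colouring : Graph → ℕ → Set
Colouring G k = Vertex G → Fin k

VertexRainbow : ∀ {G k u v} → Colouring G k → Walk G u v → Set
VertexRainbow c p = Unique (map c (internal p))

RainbowVC : (G : Graph) {k : ℕ} → Colouring G k → Set
RainbowVC G c = ∀ (u v : Vertex G) → Σ (Walk G u v) λ p → IsPath p × VertexRainbow c p

StronglyRainbowVC : (G : Graph) {k : ℕ} → Colouring G k → Set
StronglyRainbowVC G c = ∀ (u v : Vertex G) → Σ (Walk G u v) λ p → IsGeodesic p × VertexRainbow c p

-- k is the minimum number of colours with property P, with the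
-- convention that the value is 0 for complete graphs.
IsMinColours : (G : Graph) → (∀ {k} → Colouring G k → Set) → ℕ → Set
IsMinColours G P k =
  (Complete G × k ≡ 0) ⊎
  (¬ Complete G × Σ (Colouring G k) P × (∀ j → (c : Colouring G j) → P c → k ≤ j))

RVC : Graph → ℕ → Set
RVC G k = IsMinColours G (RainbowVC G) k

SRVC : Graph → ℕ → Set
SRVC G k = IsMinColours G (StronglyRainbowVC G) k

module Submission where

-- Necessity: a strongly rainbow colouring is
-- rainbow, so rvc ≤ srvc; a rainbow path with k colours has at most k + 1 edges,
-- so for k ≤ 2 it is a geodesic between vertices at distance ≥ 3, while vertices
-- at distance ≤ 2 always have rainbow geodesics; hence rvc ≤ 2 forces srvc = rvc.
-- Sufficiency: the paths P₃, P₄ realise (1,1), (2,2).  For 3 ≤ a ≤ b take a hub H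
-- with q = a - 1 ≥ 2 legs H – W i – F i and m gadgets: a clique on the Y j, with
-- 4-cycles H – Y j – L j – S j – H.  Rainbow paths between leg ends force
-- distinct colours on H and the W i (rvc ≥ q + 1); the unique geodesics
-- L j – Y j – Y j′ – L j′ force distinct colours on the clique (srvc ≥ m).
-- Explicit colourings give (a, a) with m = 0 and (a, b) with m = b > a.

open import Defs
open import Data.Bool using (Bool; true; false; not; _∨_)
open import Data.Bool.Properties using (∨-comm; ∨-identityʳ; not-¬)
import Data.Bool.Properties as Bool
open import Data.Empty using (⊥-elim)
open import Data.Fin using (Fin; zero; suc; _↑ˡ_)
open import Data.Fin.Patterns using (0F; 1F; 2F; 3F)
open import Data.Fin.Properties using (_≟_; injective⇒≤; any?; suc-injective; ↑ˡ-injective; +↔⊎)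
open import Data.List using (List; []; _∷_; _∷ʳ_; map; length; lookup; reverse; drop)
open import Data.List.Properties using (map-∘; map-cong; length-map; reverse-++; reverse-map)
open import Data.List.Membership.Propositional using (_∈_)
open import Data.List.Membership.Propositional.Properties using (∈-lookup; ∈-map⁺)
open import Data.List.Relation.Unary.All as All using ([]; _∷_)
open import Data.List.Relation.Unary.AllPairs as AllPairs using ([]; _∷_)
open import Data.List.Relation.Unary.Any using (here; there)
open import Data.List.Relation.Unary.Unique.Propositional using (Unique)
import Data.List.Relation.Unary.Unique.Propositional.Properties as Unique
open import Data.Nat using (ℕ; zero; suc; _+_; _≤_; z≤n; s≤s)
open import Data.Nat.Properties using (≤-trans; ≤-refl; ≤-antisym; m≤n⇒m<n∨m≡n; m≤n⇒∃[o]m+o≡n)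
open import Data.Product using (Σ; ∃; _×_; _,_; proj₁; proj₂; map₂)
open import Data.Sum using (_⊎_; inj₁; inj₂)
open import Data.Sum.Function.Propositional using (_⊎-↔_)
open import Function using (_∘_)
open import Function.Bundles using (_⇔_; mk⇔; _↔_; mk↔ₛ′; Inverse)
open import Function.Properties.Inverse using (↔-refl; ↔-trans)
open import Relation.Binary.PropositionalEquality
  using (_≡_; _≢_; ≢-sym; refl; trans; cong; cong₂; subst; subst₂; module ≡-Reasoning)
  renaming (sym to ≡-sym)
open import Relation.Binary.PropositionalEquality.Properties using (setoid)
open import Relation.Nullary using (¬_; yes; no; does)
open import Relation.Nullary.Decidable using (dec-true; dec-false; _×-dec_)
open import Relation.Nullary.Negation using (contradiction)

-- Pigeonhole for lists: pairwise distinct elements of Fin k number at most k.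
-- It turns "the internal colours of a path are distinct" into a length bound.
unique-length≤ : ∀ {k} (xs : List (Fin k)) → Unique xs → length xs ≤ k
unique-length≤ xs u = injective⇒≤ (lookup-injective xs u)
  where
  lookup-injective : ∀ {A : Set} (xs : List A) → Unique xs →
                     ∀ {a b} → lookup xs a ≡ lookup xs b → a ≡ b
  lookup-injective (x ∷ xs) (x∉ ∷ u) {zero}  {zero}  eq = refl
  lookup-injective (x ∷ xs) (x∉ ∷ u) {zero}  {suc b} eq = ⊥-elim (All.lookup x∉ (∈-lookup b) eq)
  lookup-injective (x ∷ xs) (x∉ ∷ u) {suc a} {zero}  eq = ⊥-elim (All.lookup x∉ (∈-lookup a) (≡-sym eq))
  lookup-injective (x ∷ xs) (x∉ ∷ u) {suc a} {suc b} eq = cong suc (lookup-injective xs u eq)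

unique-reverse : ∀ {A : Set} (xs : List A) → Unique xs → Unique (reverse xs)
unique-reverse {A} xs = Unique-resp-↭ (↭-sym (↭-reverse xs))
  where
  open import Data.List.Relation.Binary.Permutation.Setoid (setoid A) using (↭-sym)
  open import Data.List.Relation.Binary.Permutation.Setoid.Properties (setoid A)
    using (Unique-resp-↭; ↭-reverse)

unique-head : ∀ {A B : Set} (f : A → B) {a b : A} {rest : List A} →
              Unique (map f (a ∷ rest)) → b ∈ rest → f a ≢ f b
unique-head f (fa∉ ∷ _) b∈ = All.lookup fa∉ (∈-map⁺ f b∈)

map-cancel : ∀ {A B C : Set} (f : B → C) {g : A → B} {h : B → A} →
             (∀ x → g (h x) ≡ x) → ∀ xs → map (f ∘ g) (map h xs) ≡ map f xs
map-cancel f {g} {h} gh xs = trans (≡-sym (map-∘ xs)) (map-cong (cong f ∘ gh) xs)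

module _ {A : Set} where

  distinct₂ : {a b : A} → a ≢ b → Unique (a ∷ b ∷ [])
  distinct₂ ab = (ab ∷ []) ∷ [] ∷ []

  distinct₃ : {a b c : A} → a ≢ b → a ≢ c → b ≢ c → Unique (a ∷ b ∷ c ∷ [])
  distinct₃ ab ac bc = (ab ∷ ac ∷ []) ∷ (bc ∷ []) ∷ [] ∷ []

  distinct₄ : {a b c d : A} → a ≢ b → a ≢ c → a ≢ d → b ≢ c → b ≢ d → c ≢ d →
              Unique (a ∷ b ∷ c ∷ d ∷ [])
  distinct₄ ab ac ad bc bd cd = (ab ∷ ac ∷ ad ∷ []) ∷ (bc ∷ bd ∷ []) ∷ (cd ∷ []) ∷ [] ∷ []

  distinct₅ : {a b c d e : A} → a ≢ b → a ≢ c → a ≢ d → a ≢ e → b ≢ c → b ≢ d → b ≢ e →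
              c ≢ d → c ≢ e → d ≢ e → Unique (a ∷ b ∷ c ∷ d ∷ e ∷ [])
  distinct₅ ab ac ad ae bc bd be cd ce de =
    (ab ∷ ac ∷ ad ∷ ae ∷ []) ∷ (bc ∷ bd ∷ be ∷ []) ∷ (cd ∷ ce ∷ []) ∷ (de ∷ []) ∷ [] ∷ []

_==_ : ∀ {k} → Fin k → Fin k → Bool
i == j = does (i ≟ j)

==-refl : ∀ {k} (i : Fin k) → (i == i) ≡ true
==-refl i = dec-true (i ≟ i) refl

==-distinct : ∀ {k} {i j : Fin k} → i ≢ j → (i == j) ≡ false
==-distinct {i = i} {j} = dec-false (i ≟ j)

==-sound : ∀ {k} {i j : Fin k} → (i == j) ≡ true → i ≡ j
==-sound {i = i} {j} eq with i ≟ j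
... | yes i≡j = i≡j
==-sound () | no _

-- Adjacency is an edge test in either direction; when the reverse test is
-- false, adjacency is the forward test.
∨false : ∀ {b} → (b ∨ false) ≡ true → b ≡ true
∨false {b} eq = trans (≡-sym (∨-identityʳ b)) eq

-- Distance lower
-- bounds are proved here by exhausting the neighbours of the start vertex,
-- which is plain pattern matching when the vertices are named.
module Trails {V : Set} (_~_ : V → V → Set) where

  infixr 5 _∷[_]_
  data Trail : V → V → Set where
    ⟦_⟧    : (x : V) → Trail x x
    _∷[_]_ : ∀ {y z} (x : V) → x ~ y → Trail y z → Trail x z

  lengthT : ∀ {x y} → Trail x y → ℕ
  lengthT ⟦ _ ⟧        = 0
  lengthT (_ ∷[ _ ] t) = suc (lengthT t)

  verticesT : ∀ {x y} → Trail x y → List V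
  verticesT ⟦ x ⟧        = x ∷ []
  verticesT (x ∷[ _ ] t) = x ∷ verticesT t

  initT : ∀ {x y} → Trail x y → List V
  initT ⟦ _ ⟧        = []
  initT (x ∷[ _ ] t) = x ∷ initT t

  innerT : ∀ {x y} → Trail x y → List V
  innerT ⟦ _ ⟧        = []
  innerT (_ ∷[ _ ] t) = initT t

  Far : ℕ → V → V → Set
  Far k x y = (t : Trail x y) → k ≤ lengthT t

  far-weaken : ∀ {j k x y} → j ≤ k → Far k x y → Far j x y
  far-weaken j≤k far t = ≤-trans j≤k (far t)

  far-step : ∀ {k x y} → x ≢ y → (∀ z → x ~ z → Far k z y) → Far (suc k) x y
  far-step x≢y _   ⟦ _ ⟧        = ⊥-elim (x≢y refl)
  far-step _   far (_ ∷[ e ] t) = s≤s (far _ e t)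

  far-1 : ∀ {x y} → x ≢ y → Far 1 x y
  far-1 x≢y = far-step x≢y (λ _ _ _ → z≤n)

  far-2 : ∀ {x y} → x ≢ y → ¬ x ~ y → Far 2 x y
  far-2 x≢y x≁y = far-step x≢y (λ z x~z → far-1 λ { refl → x≁y x~z })

  far-3 : ∀ {x y} → x ≢ y → ¬ x ~ y → (∀ z → x ~ z → ¬ z ~ y) → Far 3 x y
  far-3 x≢y x≁y apart = far-step x≢y (λ z x~z → far-2 (λ { refl → x≁y x~z }) (apart z x~z))

  start∈verticesT : ∀ {x y} (t : Trail x y) → x ∈ verticesT t
  start∈verticesT ⟦ _ ⟧        = here refl
  start∈verticesT (_ ∷[ _ ] _) = here refl

  start∈initT : ∀ {x y} → x ≢ y → (t : Trail x y) → x ∈ initT t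
  start∈initT x≢y ⟦ _ ⟧        = ⊥-elim (x≢y refl)
  start∈initT _   (_ ∷[ _ ] _) = here refl

  penultimate : ∀ {x y} → x ≢ y → (t : Trail x y) → ∃ λ z → z ~ y × z ∈ initT t
  penultimate x≢y ⟦ _ ⟧        = ⊥-elim (x≢y refl)
  penultimate _   (x ∷[ e ] t) = last-edge x e t
    where
    last-edge : ∀ {y z} (x : V) → x ~ y → (t : Trail y z) → ∃ λ w → w ~ z × w ∈ x ∷ initT t
    last-edge x e ⟦ _ ⟧          = x , e , here refl
    last-edge _ _ (y ∷[ e′ ] t′) = map₂ (map₂ there) (last-edge y e′ t′)

module WalkFacts (G : Graph) where

  adj⇒≢ : ∀ {u v} → Adj G u v → u ≢ v
  adj⇒≢ {u} e refl with trans (≡-sym e) (irrefl G u)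
  ... | ()

  adj-sym : ∀ {u v} → Adj G u v → Adj G v u
  adj-sym {u} {v} e = trans (Graph.sym G v u) e

  RainbowPath : ∀ {k} → Colouring G k → Vertex G → Vertex G → Set
  RainbowPath c u v = Σ (Walk G u v) λ p → IsPath p × VertexRainbow c p

  RainbowGeodesic : ∀ {k} → Colouring G k → Vertex G → Vertex G → Set
  RainbowGeodesic c u v = Σ (Walk G u v) λ p → IsGeodesic p × VertexRainbow c p

  geodesic⇒path : ∀ {k} {c : Colouring G k} {u v} → RainbowGeodesic c u v → RainbowPath c u v
  geodesic⇒path (p , (isPath , _) , rainbow) = p , isPath , rainbow

  -- A walk has one edge more than internal vertices; so a rainbow walk
  -- coloured with k colours has at most k + 1 edges.
  length-dropLast : ∀ {u v} (p : Walk G u v) → length (dropLast p) ≡ len p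
  length-dropLast [ _ ]         = refl
  length-dropLast (_ ∷⟨ _ ⟩ p) = cong suc (length-dropLast p)

  rainbow-len≤ : ∀ {k} (c : Colouring G k) {u v} (p : Walk G u v) → VertexRainbow c p → len p ≤ suc k
  rainbow-len≤ c [ _ ]         _       = z≤n
  rainbow-len≤ c (_ ∷⟨ _ ⟩ p) rainbow = s≤s (begin
    len p                        ≡⟨ length-dropLast p ⟨
    length (dropLast p)          ≡⟨ length-map c (dropLast p) ⟨
    length (map c (dropLast p))  ≤⟨ unique-length≤ _ rainbow ⟩
    _                            ∎)
    where open Data.Nat.Properties.≤-Reasoning

  snoc : ∀ {u v w} → Walk G u v → Adj G v w → Walk G u w
  snoc [ u ]         e = u ∷⟨ e ⟩ [ _ ]
  snoc (u ∷⟨ e′ ⟩ p) e = u ∷⟨ e′ ⟩ snoc p e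

  reverseW : ∀ {u v} → Walk G u v → Walk G v u
  reverseW [ u ]         = [ u ]
  reverseW (u ∷⟨ e ⟩ p) = snoc (reverseW p) (adj-sym e)

  len-snoc : ∀ {u v w} (p : Walk G u v) (e : Adj G v w) → len (snoc p e) ≡ suc (len p)
  len-snoc [ _ ]         e = refl
  len-snoc (_ ∷⟨ _ ⟩ p) e = cong suc (len-snoc p e)

  len-reverse : ∀ {u v} (p : Walk G u v) → len (reverseW p) ≡ len p
  len-reverse [ _ ]         = refl
  len-reverse (_ ∷⟨ e ⟩ p) = trans (len-snoc (reverseW p) _) (cong suc (len-reverse p))

  vertices-snoc : ∀ {u v w} (p : Walk G u v) (e : Adj G v w) → vertices (snoc p e) ≡ vertices p ∷ʳ w
  vertices-snoc [ _ ]         e = refl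
  vertices-snoc (x ∷⟨ _ ⟩ p) e = cong (x ∷_) (vertices-snoc p e)

  dropLast-snoc : ∀ {u v w} (p : Walk G u v) (e : Adj G v w) → dropLast (snoc p e) ≡ vertices p
  dropLast-snoc [ _ ]         e = refl
  dropLast-snoc (x ∷⟨ _ ⟩ p) e = cong (x ∷_) (dropLast-snoc p e)

  internal-snoc : ∀ {u v w} (p : Walk G u v) (e : Adj G v w) → internal (snoc p e) ≡ drop 1 (vertices p)
  internal-snoc [ _ ]         e = refl
  internal-snoc (_ ∷⟨ _ ⟩ p) e = dropLast-snoc p e

  vertices-dropLast : ∀ {u v} (p : Walk G u v) → vertices p ≡ dropLast p ∷ʳ v
  vertices-dropLast [ _ ]         = refl
  vertices-dropLast (x ∷⟨ _ ⟩ p) = cong (x ∷_) (vertices-dropLast p)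

  vertices-reverse : ∀ {u v} (p : Walk G u v) → vertices (reverseW p) ≡ reverse (vertices p)
  vertices-reverse [ _ ]         = refl
  vertices-reverse (u ∷⟨ e ⟩ p) = begin
    vertices (snoc (reverseW p) (adj-sym e)) ≡⟨ vertices-snoc (reverseW p) _ ⟩
    vertices (reverseW p) ∷ʳ u               ≡⟨ cong (_∷ʳ u) (vertices-reverse p) ⟩
    reverse (vertices p) ∷ʳ u                ≡⟨ reverse-++ (u ∷ []) (vertices p) ⟨
    reverse (u ∷ vertices p)                 ∎
    where open ≡-Reasoning

  internal-reverse : ∀ {u v} (p : Walk G u v) → internal (reverseW p) ≡ reverse (internal p)
  internal-reverse [ _ ]                 = refl
  internal-reverse {v = v} (_ ∷⟨ e ⟩ p) = begin
    internal (snoc (reverseW p) (adj-sym e)) ≡⟨ internal-snoc (reverseW p) _ ⟩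
    drop 1 (vertices (reverseW p))           ≡⟨ cong (drop 1) (vertices-reverse p) ⟩
    drop 1 (reverse (vertices p))            ≡⟨ cong (drop 1 ∘ reverse) (vertices-dropLast p) ⟩
    drop 1 (reverse (dropLast p ∷ʳ v))       ≡⟨ cong (drop 1) (reverse-++ (dropLast p) (v ∷ [])) ⟩
    reverse (dropLast p)                     ∎
    where open ≡-Reasoning

  reverse-isPath : ∀ {u v} (p : Walk G u v) → IsPath p → IsPath (reverseW p)
  reverse-isPath p isPath = subst Unique (≡-sym (vertices-reverse p)) (unique-reverse _ isPath)

  reverse-rainbow : ∀ {k} (c : Colouring G k) {u v} (p : Walk G u v) →
                    VertexRainbow c p → VertexRainbow c (reverseW p)
  reverse-rainbow c p rainbow = subst Unique
    (≡-sym (trans (cong (map c) (internal-reverse p)) (reverse-map c (internal p))))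
    (unique-reverse _ rainbow)

  path-sym : ∀ {k} (c : Colouring G k) {u v} → RainbowPath c u v → RainbowPath c v u
  path-sym c (p , isPath , rainbow) = reverseW p , reverse-isPath p isPath , reverse-rainbow c p rainbow

  -- Reversal is a length-preserving bijection on paths, so it maps geodesics to geodesics.
  geodesic-sym : ∀ {k} (c : Colouring G k) {u v} → RainbowGeodesic c u v → RainbowGeodesic c v u
  geodesic-sym c (p , (isPath , shortest) , rainbow) =
    reverseW p , (reverse-isPath p isPath , shortest′) , reverse-rainbow c p rainbow
    where
    shortest′ : ∀ q → IsPath q → len (reverseW p) ≤ len q
    shortest′ q isPath-q = subst₂ _≤_ (≡-sym (len-reverse p)) (len-reverse q)
      (shortest (reverseW q) (reverse-isPath q isPath-q))

module FewColours (G : Graph) where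
  open WalkFacts G
  open Trails (Adj G)

  toTrail : ∀ {u v} → Walk G u v → Trail u v
  toTrail [ u ]         = ⟦ u ⟧
  toTrail (u ∷⟨ e ⟩ p) = u ∷[ e ] toTrail p

  lengthT-toTrail : ∀ {u v} (p : Walk G u v) → lengthT (toTrail p) ≡ len p
  lengthT-toTrail [ _ ]         = refl
  lengthT-toTrail (_ ∷⟨ _ ⟩ p) = cong suc (lengthT-toTrail p)

  far⇒≤len : ∀ {k u v} → Far k u v → (p : Walk G u v) → k ≤ len p
  far⇒≤len {k} far p = subst (k ≤_) (lengthT-toTrail p) (far (toTrail p))

  -- Vertices at distance 0, 1 or 2 are joined by geodesics with at most one
  -- internal vertex, which are rainbow for every colouring.
  geodesic-refl : ∀ {k} (c : Colouring G k) u → RainbowGeodesic c u u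
  geodesic-refl c u = [ u ] , (([] ∷ []) , λ _ _ → z≤n) , []

  geodesic-edge : ∀ {k} (c : Colouring G k) {u v} → Adj G u v → RainbowGeodesic c u v
  geodesic-edge c {u} {v} e =
    (u ∷⟨ e ⟩ [ v ]) , (distinct₂ (adj⇒≢ e) , λ q _ → far⇒≤len (far-1 (adj⇒≢ e)) q) , []

  geodesic-corner : ∀ {k} (c : Colouring G k) {u w v} → Adj G u w → Adj G w v →
                    u ≢ v → ¬ Adj G u v → RainbowGeodesic c u v
  geodesic-corner c {u} {w} {v} e₁ e₂ u≢v u≁v =
    (u ∷⟨ e₁ ⟩ (w ∷⟨ e₂ ⟩ [ v ])) ,
    (distinct₃ (adj⇒≢ e₁) u≢v (adj⇒≢ e₂) , λ q _ → far⇒≤len (far-2 u≢v u≁v) q) , [] ∷ []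

  -- A rainbow path with k colours has at most k + 1 edges, so it is a
  -- geodesic between vertices at distance at least k + 1.
  rainbow-geodesic : ∀ {k} (c : Colouring G k) {u v} → Far (suc k) u v →
                     RainbowPath c u v → RainbowGeodesic c u v
  rainbow-geodesic c far (p , isPath , rainbow) =
    p , (isPath , λ q _ → ≤-trans (rainbow-len≤ c p rainbow) (far⇒≤len far q)) , rainbow

  -- With at most two colours every rainbow colouring is strongly rainbow:
  -- vertices without a common neighbour are at distance ≥ 3 ≥ k + 1.
  few-colours-strong : ∀ {k} → k ≤ 2 → (c : Colouring G k) → RainbowVC G c → StronglyRainbowVC G c
  few-colours-strong k≤2 c rainbowVC u v with u ≟ v
  ... | yes refl = geodesic-refl c u
  ... | no u≢v with adj G u v in uv
  ...   | true  = geodesic-edge c uv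
  ...   | false with any? (λ w → (adj G u w Bool.≟ true) ×-dec (adj G w v Bool.≟ true))
  ...     | yes (w , e₁ , e₂) = geodesic-corner c e₁ e₂ u≢v (not-¬ uv)
  ...     | no no-corner =
    rainbow-geodesic c (far-weaken (s≤s k≤2) far) (rainbowVC u v)
    where
    far : Far 3 u v
    far = far-3 u≢v (not-¬ uv) (λ w e₁ e₂ → no-corner (w , e₁ , e₂))

module MinColours (G : Graph) where
  open WalkFacts G

  strong⇒rainbow : ∀ {k} (c : Colouring G k) → StronglyRainbowVC G c → RainbowVC G c
  strong⇒rainbow c strongVC u v = geodesic⇒path (strongVC u v)

  connected : ∀ {k} (c : Colouring G k) → RainbowVC G c → Vertex G → Connected G
  connected c rainbowVC u₀ = u₀ , λ u v → proj₁ (rainbowVC u v) , proj₁ (proj₂ (rainbowVC u v))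

  colours-positive : ∀ {k} → Colouring G k → Vertex G → 1 ≤ k
  colours-positive {zero}  c u with c u
  ... | ()
  colours-positive {suc _} _ _ = s≤s z≤n

  equal-values : ∀ {k} → ¬ Complete G → (c : Colouring G k) → StronglyRainbowVC G c →
                 (∀ j (c′ : Colouring G j) → RainbowVC G c′ → k ≤ j) → RVC G k × SRVC G k
  equal-values not-complete c strongVC minimal =
    inj₂ (not-complete , (c , strong⇒rainbow c strongVC) , minimal) ,
    inj₂ (not-complete , (c , strongVC) , λ j c′ strongVC′ → minimal j c′ (strong⇒rainbow c′ strongVC′))

-- The arithmetic core of necessity: given rvc ≤ srvc, and srvc ≤ rvc when rvc ≤ 2.
admissible : ∀ {a b} → 1 ≤ a → a ≤ b → (a ≤ 2 → b ≤ a) → (a ≡ b × (a ≡ 1 ⊎ a ≡ 2)) ⊎ (3 ≤ a × a ≤ b)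
admissible {1}                 _ a≤b b≤a = inj₁ (≤-antisym a≤b (b≤a (s≤s z≤n)) , inj₁ refl)
admissible {2}                 _ a≤b b≤a = inj₁ (≤-antisym a≤b (b≤a ≤-refl) , inj₂ refl)
admissible {suc (suc (suc _))} _ a≤b _   = inj₂ (s≤s (s≤s (s≤s z≤n)) , a≤b)

necessity : ∀ {a b} → 1 ≤ a → 1 ≤ b → Σ Graph (λ G → Connected G × RVC G a × SRVC G b) →
            (a ≡ b × (a ≡ 1 ⊎ a ≡ 2)) ⊎ (3 ≤ a × a ≤ b)
necessity () _ (_ , _ , inj₁ (_ , refl) , _)
necessity _ () (_ , _ , inj₂ _ , inj₁ (_ , refl))
necessity {a} {b} 1≤a _ (G , _ , inj₂ (_ , (cᵣ , rainbowVC) , minᵣ) , inj₂ (_ , (cₛ , strongVC) , minₛ)) =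
  admissible 1≤a (minᵣ b cₛ (strong⇒rainbow cₛ strongVC))
                 (λ a≤2 → minₛ a cᵣ (few-colours-strong a≤2 cᵣ rainbowVC))
  where
  open MinColours G
  open FewColours G

-- A graph presented on a finite type V of vertex names (enumerated by
-- Fin size), from a loopless Boolean edge test `edge` in either direction.
-- Walks of the graph and trails of names correspond, so paths are built and
-- distances bounded on names, then transferred to the graph.
module NamedGraph {V : Set} {size : ℕ} (names : Fin size ↔ V)
                  (edge : V → V → Bool) (loopless : ∀ x → edge x x ≡ false) where

  name : Fin size → V
  name = Inverse.to names

  code : V → Fin size
  code = Inverse.from names

  name-code : ∀ x → name (code x) ≡ x
  name-code = Inverse.strictlyInverseˡ names

  code-name : ∀ u → code (name u) ≡ u
  code-name = Inverse.strictlyInverseʳ names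

  code-injective : ∀ {x y} → code x ≡ code y → x ≡ y
  code-injective {x} {y} eq = trans (≡-sym (name-code x)) (trans (cong name eq) (name-code y))

  name-injective : ∀ {u v} → name u ≡ name v → u ≡ v
  name-injective {u} {v} eq = trans (≡-sym (code-name u)) (trans (cong code eq) (code-name v))

  _~_ : V → V → Set
  x ~ y = (edge x y ∨ edge y x) ≡ true

  graph : Graph
  graph = record
    { n      = size
    ; adj    = λ u v → edge (name u) (name v) ∨ edge (name v) (name u)
    ; sym    = λ u v → ∨-comm (edge (name u) (name v)) (edge (name v) (name u))
    ; irrefl = λ u → cong₂ _∨_ (loopless (name u)) (loopless (name u))
    }

  open Trails _~_ public
  open WalkFacts graph public
  open MinColours graph public

  ~-sym : ∀ {x y} → x ~ y → y ~ x
  ~-sym {x} {y} e = trans (∨-comm (edge y x) (edge x y)) e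

  edge→ : ∀ {x y} → edge x y ≡ true → x ~ y
  edge→ {x} {y} e = cong (_∨ edge y x) e

  not-complete : ∀ {x y} → x ≢ y → ¬ x ~ y → ¬ Complete graph
  not-complete {x} {y} x≢y x≁y complete =
    x≁y (subst₂ _~_ (name-code x) (name-code y) (complete (code x) (code y) (x≢y ∘ code-injective)))

  allPairs : {P : Vertex graph → Vertex graph → Set} → (∀ x y → P (code x) (code y)) → ∀ u v → P u v
  allPairs {P} h u v = subst₂ P (code-name u) (code-name v) (h (name u) (name v))

  toWalk : ∀ {x y} → Trail x y → Walk graph (code x) (code y)
  toWalk ⟦ x ⟧        = [ code x ]
  toWalk (x ∷[ e ] t) = code x ∷⟨ subst₂ _~_ (≡-sym (name-code x)) (≡-sym (name-code _)) e ⟩ toWalk t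

  len-toWalk : ∀ {x y} (t : Trail x y) → len (toWalk t) ≡ lengthT t
  len-toWalk ⟦ _ ⟧        = refl
  len-toWalk (_ ∷[ _ ] t) = cong suc (len-toWalk t)

  vertices-toWalk : ∀ {x y} (t : Trail x y) → vertices (toWalk t) ≡ map code (verticesT t)
  vertices-toWalk ⟦ _ ⟧        = refl
  vertices-toWalk (x ∷[ _ ] t) = cong (code x ∷_) (vertices-toWalk t)

  dropLast-toWalk : ∀ {x y} (t : Trail x y) → dropLast (toWalk t) ≡ map code (initT t)
  dropLast-toWalk ⟦ _ ⟧        = refl
  dropLast-toWalk (x ∷[ _ ] t) = cong (code x ∷_) (dropLast-toWalk t)

  internal-toWalk : ∀ {x y} (t : Trail x y) → internal (toWalk t) ≡ map code (innerT t)
  internal-toWalk ⟦ _ ⟧        = refl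
  internal-toWalk (_ ∷[ _ ] t) = dropLast-toWalk t

  fromWalk : ∀ {u v} → Walk graph u v → Trail (name u) (name v)
  fromWalk [ u ]         = ⟦ name u ⟧
  fromWalk (u ∷⟨ e ⟩ p) = name u ∷[ e ] fromWalk p

  lengthT-fromWalk : ∀ {u v} (p : Walk graph u v) → lengthT (fromWalk p) ≡ len p
  lengthT-fromWalk [ _ ]         = refl
  lengthT-fromWalk (_ ∷⟨ _ ⟩ p) = cong suc (lengthT-fromWalk p)

  verticesT-fromWalk : ∀ {u v} (p : Walk graph u v) → verticesT (fromWalk p) ≡ map name (vertices p)
  verticesT-fromWalk [ _ ]         = refl
  verticesT-fromWalk (u ∷⟨ _ ⟩ p) = cong (name u ∷_) (verticesT-fromWalk p)

  initT-fromWalk : ∀ {u v} (p : Walk graph u v) → initT (fromWalk p) ≡ map name (dropLast p)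
  initT-fromWalk [ _ ]         = refl
  initT-fromWalk (u ∷⟨ _ ⟩ p) = cong (name u ∷_) (initT-fromWalk p)

  innerT-fromWalk : ∀ {u v} (p : Walk graph u v) → innerT (fromWalk p) ≡ map name (internal p)
  innerT-fromWalk [ _ ]         = refl
  innerT-fromWalk (_ ∷⟨ _ ⟩ p) = initT-fromWalk p

  path-fromWalk : ∀ {u v} (p : Walk graph u v) → IsPath p → Unique (verticesT (fromWalk p))
  path-fromWalk p isPath = subst Unique (≡-sym (verticesT-fromWalk p)) (Unique.map⁺ name-injective isPath)

  rainbow-fromWalk : ∀ {k} (cc : Colouring graph k) {u v} (p : Walk graph u v) →
                     VertexRainbow cc p → Unique (map (cc ∘ code) (innerT (fromWalk p)))
  rainbow-fromWalk cc p rainbow = subst Unique (≡-sym (begin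
    map (cc ∘ code) (innerT (fromWalk p))     ≡⟨ cong (map (cc ∘ code)) (innerT-fromWalk p) ⟩
    map (cc ∘ code) (map name (internal p))   ≡⟨ map-cancel cc code-name (internal p) ⟩
    map cc (internal p)                       ∎)) rainbow
    where open ≡-Reasoning

  farNames⇒≤len : ∀ {k x y} → Far k x y → (q : Walk graph (code x) (code y)) → k ≤ len q
  farNames⇒≤len {k} {x} {y} far q =
    subst (k ≤_) (lengthT-fromWalk q) (subst₂ (Far k) (≡-sym (name-code x)) (≡-sym (name-code y)) far (fromWalk q))

  toWalk-isPath : ∀ {x y} (t : Trail x y) → Unique (verticesT t) → IsPath (toWalk t)
  toWalk-isPath t distinct = subst Unique (≡-sym (vertices-toWalk t)) (Unique.map⁺ code-injective distinct)

  toWalk-rainbow : ∀ {k} (col : V → Fin k) {x y} (t : Trail x y) →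
                   Unique (map col (innerT t)) → VertexRainbow (col ∘ name) (toWalk t)
  toWalk-rainbow col t rainbow = subst Unique (≡-sym (begin
    map (col ∘ name) (internal (toWalk t))   ≡⟨ cong (map (col ∘ name)) (internal-toWalk t) ⟩
    map (col ∘ name) (map code (innerT t))   ≡⟨ map-cancel col name-code (innerT t) ⟩
    map col (innerT t)                       ∎)) rainbow
    where open ≡-Reasoning

  pathOf : ∀ {k} (col : V → Fin k) {x y} (t : Trail x y) → Unique (verticesT t) →
           Unique (map col (innerT t)) → RainbowPath (col ∘ name) (code x) (code y)
  pathOf col t distinct rainbow = toWalk t , toWalk-isPath t distinct , toWalk-rainbow col t rainbow

  geodesicOf : ∀ {k} (col : V → Fin k) {x y} (t : Trail x y) → Unique (verticesT t) →
               Far (lengthT t) x y → Unique (map col (innerT t)) → RainbowGeodesic (col ∘ name) (code x) (code y)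
  geodesicOf col t distinct far rainbow =
    toWalk t ,
    (toWalk-isPath t distinct , λ q _ → subst (_≤ len q) (≡-sym (len-toWalk t)) (farNames⇒≤len far q)) ,
    toWalk-rainbow col t rainbow

  geodesic-self : ∀ {k} (col : V → Fin k) x → RainbowGeodesic (col ∘ name) (code x) (code x)
  geodesic-self col x = geodesicOf col ⟦ x ⟧ ([] ∷ []) (λ _ → z≤n) []

module Path3 where

  edge : Fin 3 → Fin 3 → Bool
  edge 0F 1F = true
  edge 1F 2F = true
  edge _  _  = false

  loopless : ∀ x → edge x x ≡ false
  loopless 0F = refl
  loopless 1F = refl
  loopless 2F = refl

  open NamedGraph ↔-refl edge loopless public

  colour : Fin 3 → Fin 1
  colour _ = zero

  geodesics : ∀ x y → RainbowGeodesic (colour ∘ name) (code x) (code y)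
  geodesics 0F 1F = geodesicOf colour (0F ∷[ refl ] ⟦ 1F ⟧) (distinct₂ (λ ())) (far-1 (λ ())) []
  geodesics 1F 2F = geodesicOf colour (1F ∷[ refl ] ⟦ 2F ⟧) (distinct₂ (λ ())) (far-1 (λ ())) []
  geodesics 0F 2F = geodesicOf colour (0F ∷[ refl ] 1F ∷[ refl ] ⟦ 2F ⟧)
                      (distinct₃ (λ ()) (λ ()) (λ ())) (far-2 (λ ()) (λ ())) ([] ∷ [])
  geodesics 1F 0F = geodesic-sym _ (geodesics 0F 1F)
  geodesics 2F 1F = geodesic-sym _ (geodesics 1F 2F)
  geodesics 2F 0F = geodesic-sym _ (geodesics 0F 2F)
  geodesics 0F 0F = geodesic-self colour 0F
  geodesics 1F 1F = geodesic-self colour 1F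
  geodesics 2F 2F = geodesic-self colour 2F

  values : Connected graph × RVC graph 1 × SRVC graph 1
  values = connected c (strong⇒rainbow c strongVC) 0F ,
           equal-values (not-complete {0F} {2F} (λ ()) (λ ())) c strongVC (λ _ c′ _ → colours-positive c′ 0F)
    where
    c : Colouring graph 1
    c = colour ∘ name
    strongVC : StronglyRainbowVC graph c
    strongVC = allPairs geodesics

-- The path P₄ = 0 – 1 – 2 – 3 realises rvc = srvc = 2: the rainbow path
-- between its ends has two internal vertices.
module Path4 where

  edge : Fin 4 → Fin 4 → Bool
  edge 0F 1F = true
  edge 1F 2F = true
  edge 2F 3F = true
  edge _  _  = false

  loopless : ∀ x → edge x x ≡ false
  loopless 0F = refl
  loopless 1F = refl
  loopless 2F = refl
  loopless 3F = refl

  open NamedGraph ↔-refl edge loopless public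

  colour : Fin 4 → Fin 2
  colour 2F = 1F
  colour _  = 0F

  far-ends : Far 3 0F 3F
  far-ends = far-3 (λ ()) (λ ()) apart
    where
    apart : ∀ z → 0F ~ z → ¬ z ~ 3F
    apart 0F ()
    apart 1F _ ()
    apart 2F ()
    apart 3F ()

  geodesics : ∀ x y → RainbowGeodesic (colour ∘ name) (code x) (code y)
  geodesics 0F 1F = geodesicOf colour (0F ∷[ refl ] ⟦ 1F ⟧) (distinct₂ (λ ())) (far-1 (λ ())) []
  geodesics 1F 2F = geodesicOf colour (1F ∷[ refl ] ⟦ 2F ⟧) (distinct₂ (λ ())) (far-1 (λ ())) []
  geodesics 2F 3F = geodesicOf colour (2F ∷[ refl ] ⟦ 3F ⟧) (distinct₂ (λ ())) (far-1 (λ ())) []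
  geodesics 0F 2F = geodesicOf colour (0F ∷[ refl ] 1F ∷[ refl ] ⟦ 2F ⟧)
                      (distinct₃ (λ ()) (λ ()) (λ ())) (far-2 (λ ()) (λ ())) ([] ∷ [])
  geodesics 1F 3F = geodesicOf colour (1F ∷[ refl ] 2F ∷[ refl ] ⟦ 3F ⟧)
                      (distinct₃ (λ ()) (λ ()) (λ ())) (far-2 (λ ()) (λ ())) ([] ∷ [])
  geodesics 0F 3F = geodesicOf colour (0F ∷[ refl ] 1F ∷[ refl ] 2F ∷[ refl ] ⟦ 3F ⟧)
                      (distinct₄ (λ ()) (λ ()) (λ ()) (λ ()) (λ ()) (λ ())) far-ends (distinct₂ (λ ()))
  geodesics 1F 0F = geodesic-sym _ (geodesics 0F 1F)
  geodesics 2F 1F = geodesic-sym _ (geodesics 1F 2F)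
  geodesics 3F 2F = geodesic-sym _ (geodesics 2F 3F)
  geodesics 2F 0F = geodesic-sym _ (geodesics 0F 2F)
  geodesics 3F 1F = geodesic-sym _ (geodesics 1F 3F)
  geodesics 3F 0F = geodesic-sym _ (geodesics 0F 3F)
  geodesics 0F 0F = geodesic-self colour 0F
  geodesics 1F 1F = geodesic-self colour 1F
  geodesics 2F 2F = geodesic-self colour 2F
  geodesics 3F 3F = geodesic-self colour 3F

  two-colours-needed : ∀ j (cc : Colouring graph j) → RainbowVC graph cc → 2 ≤ j
  two-colours-needed j cc rainbowVC with rainbowVC (code 0F) (code 3F)
  ... | p , _ , rainbow with ≤-trans (farNames⇒≤len far-ends p) (rainbow-len≤ cc p rainbow)
  ...   | s≤s 2≤j = 2≤j

  values : Connected graph × RVC graph 2 × SRVC graph 2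
  values = connected c (strong⇒rainbow c strongVC) 0F ,
           equal-values (not-complete {0F} {2F} (λ ()) (λ ())) c strongVC two-colours-needed
    where
    c : Colouring graph 2
    c = colour ∘ name
    strongVC : StronglyRainbowVC graph c
    strongVC = allPairs geodesics

module Family (q m : ℕ) where

  -- H is the hub, leg i is H – W i – F i, gadget j is Y j, L j, S j.
  data Name : Set where
    H     : Name
    W F   : Fin q → Name
    Y S L : Fin m → Name

  Parts : Set
  Parts = Fin 1 ⊎ Fin q ⊎ Fin q ⊎ Fin m ⊎ Fin m ⊎ Fin m

  fromParts : Parts → Name
  fromParts (inj₁ _)                                = H
  fromParts (inj₂ (inj₁ i))                         = W i
  fromParts (inj₂ (inj₂ (inj₁ i)))                  = F i
  fromParts (inj₂ (inj₂ (inj₂ (inj₁ j))))           = Y j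
  fromParts (inj₂ (inj₂ (inj₂ (inj₂ (inj₁ j)))))    = S j
  fromParts (inj₂ (inj₂ (inj₂ (inj₂ (inj₂ j)))))    = L j

  toParts : Name → Parts
  toParts H     = inj₁ zero
  toParts (W i) = inj₂ (inj₁ i)
  toParts (F i) = inj₂ (inj₂ (inj₁ i))
  toParts (Y j) = inj₂ (inj₂ (inj₂ (inj₁ j)))
  toParts (S j) = inj₂ (inj₂ (inj₂ (inj₂ (inj₁ j))))
  toParts (L j) = inj₂ (inj₂ (inj₂ (inj₂ (inj₂ j))))

  fromParts-toParts : ∀ x → fromParts (toParts x) ≡ x
  fromParts-toParts H     = refl
  fromParts-toParts (W _) = refl
  fromParts-toParts (F _) = refl
  fromParts-toParts (Y _) = refl
  fromParts-toParts (S _) = refl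
  fromParts-toParts (L _) = refl

  toParts-fromParts : ∀ p → toParts (fromParts p) ≡ p
  toParts-fromParts (inj₁ zero)                             = refl
  toParts-fromParts (inj₂ (inj₁ _))                         = refl
  toParts-fromParts (inj₂ (inj₂ (inj₁ _)))                  = refl
  toParts-fromParts (inj₂ (inj₂ (inj₂ (inj₁ _))))           = refl
  toParts-fromParts (inj₂ (inj₂ (inj₂ (inj₂ (inj₁ _)))))    = refl
  toParts-fromParts (inj₂ (inj₂ (inj₂ (inj₂ (inj₂ _)))))    = refl

  names : Fin (1 + (q + (q + (m + (m + m))))) ↔ Name
  names = ↔-trans (split 1 (split q (split q (split m +↔⊎))))
                  (mk↔ₛ′ fromParts toParts fromParts-toParts toParts-fromParts)
    where
    split : ∀ a {b} {A : Set} → Fin b ↔ A → Fin (a + b) ↔ (Fin a ⊎ A)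
    split a e = ↔-trans (+↔⊎ {a}) (↔-refl ⊎-↔ e)

  edge : Name → Name → Bool
  edge H     (W _)  = true
  edge H     (Y _)  = true
  edge H     (S _)  = true
  edge (W i) (F i′) = i == i′
  edge (Y j) (Y j′) = not (j == j′)
  edge (Y j) (L j′) = j == j′
  edge (S j) (L j′) = j == j′
  edge _     _      = false

  loopless : ∀ x → edge x x ≡ false
  loopless H     = refl
  loopless (W _) = refl
  loopless (F _) = refl
  loopless (Y j) = cong not (==-refl j)
  loopless (S _) = refl
  loopless (L _) = refl

  open NamedGraph names edge loopless public

  W~F : ∀ i → W i ~ F i
  W~F i = edge→ {W i} {F i} (==-refl i)

  F~W : ∀ i → F i ~ W i
  F~W i = ==-refl i

  L~Y : ∀ j → L j ~ Y j
  L~Y j = ==-refl j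

  Y~L : ∀ j → Y j ~ L j
  Y~L j = edge→ {Y j} {L j} (==-refl j)

  S~L : ∀ j → S j ~ L j
  S~L j = edge→ {S j} {L j} (==-refl j)

  Y~Y : ∀ {j j′} → j ≢ j′ → Y j ~ Y j′
  Y~Y {j} {j′} j≢j′ = edge→ {Y j} {Y j′} (cong not (==-distinct j≢j′))

  W≢ : ∀ {i i′} → i ≢ i′ → W i ≢ W i′
  W≢ i≢i′ refl = i≢i′ refl

  F≢ : ∀ {i i′} → i ≢ i′ → F i ≢ F i′
  F≢ i≢i′ refl = i≢i′ refl

  Y≢ : ∀ {j j′} → j ≢ j′ → Y j ≢ Y j′
  Y≢ j≢j′ refl = j≢j′ refl

  S≢ : ∀ {j j′} → j ≢ j′ → S j ≢ S j′
  S≢ j≢j′ refl = j≢j′ refl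

  L≢ : ∀ {j j′} → j ≢ j′ → L j ≢ L j′
  L≢ j≢j′ refl = j≢j′ refl

  nbr-F : ∀ {i z} → F i ~ z → z ≡ W i
  nbr-F {z = W _} e = cong W (==-sound e)
  nbr-F {z = H}   ()
  nbr-F {z = F _} ()
  nbr-F {z = Y _} ()
  nbr-F {z = S _} ()
  nbr-F {z = L _} ()

  nbr-W : ∀ {i z} → W i ~ z → z ≡ H ⊎ z ≡ F i
  nbr-W {z = H}   _ = inj₁ refl
  nbr-W {z = F _} e = inj₂ (cong F (≡-sym (==-sound (∨false e))))
  nbr-W {z = W _} ()
  nbr-W {z = Y _} ()
  nbr-W {z = S _} ()
  nbr-W {z = L _} ()

  nbr-S : ∀ {j z} → S j ~ z → z ≡ H ⊎ z ≡ L j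
  nbr-S {z = H}   _ = inj₁ refl
  nbr-S {z = L _} e = inj₂ (cong L (≡-sym (==-sound (∨false e))))
  nbr-S {z = W _} ()
  nbr-S {z = F _} ()
  nbr-S {z = Y _} ()
  nbr-S {z = S _} ()

  nbr-L : ∀ {j z} → L j ~ z → z ≡ Y j ⊎ z ≡ S j
  nbr-L {z = Y _} e = inj₁ (cong Y (==-sound e))
  nbr-L {z = S _} e = inj₂ (cong S (==-sound e))
  nbr-L {z = H}   ()
  nbr-L {z = W _} ()
  nbr-L {z = F _} ()
  nbr-L {z = L _} ()

  -- Distance lower bounds.  A leg end F i is only reachable through W i.
  far-F : ∀ {k i y} → F i ≢ y → Far k (W i) y → Far (suc k) (F i) y
  far-F F≢y far = far-step F≢y (λ z e → subst (λ z → Far _ z _) (≡-sym (nbr-F {z = z} e)) far)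

  far-WF : ∀ {i i′} → i ≢ i′ → Far 3 (W i) (F i′)
  far-WF {i} {i′} i≢i′ = far-3 (λ ()) (i≢i′ ∘ ==-sound ∘ ∨false) apart
    where
    apart : ∀ z → W i ~ z → ¬ z ~ F i′
    apart z e with nbr-W {z = z} e
    ... | inj₁ refl = λ ()
    ... | inj₂ refl = λ ()

  far-WL : ∀ {i j} → Far 3 (W i) (L j)
  far-WL {i} {j} = far-3 (λ ()) (λ ()) apart
    where
    apart : ∀ z → W i ~ z → ¬ z ~ L j
    apart z e with nbr-W {z = z} e
    ... | inj₁ refl = λ ()
    ... | inj₂ refl = λ ()

  far-SL : ∀ {j j′} → j ≢ j′ → Far 3 (S j) (L j′)
  far-SL {j} {j′} j≢j′ = far-3 (λ ()) (j≢j′ ∘ ==-sound ∘ ∨false) apart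
    where
    apart : ∀ z → S j ~ z → ¬ z ~ L j′
    apart z e with nbr-S {z = z} e
    ... | inj₁ refl = λ ()
    ... | inj₂ refl = λ ()

  far-LL : ∀ {j j′} → j ≢ j′ → Far 3 (L j) (L j′)
  far-LL {j} {j′} j≢j′ = far-3 (L≢ j≢j′) (λ ()) apart
    where
    apart : ∀ z → L j ~ z → ¬ z ~ L j′
    apart z e with nbr-L {z = z} e
    ... | inj₁ refl = j≢j′ ∘ ==-sound ∘ ∨false
    ... | inj₂ refl = j≢j′ ∘ ==-sound ∘ ∨false

  module Geodesics {k : ℕ} (col : Name → Fin k)
      (W≉H : ∀ i → col (W i) ≢ col H)
      (W≉W : ∀ {i i′} → i ≢ i′ → col (W i) ≢ col (W i′))
      (S≉H : ∀ j → col (S j) ≢ col H) where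

    c : Colouring graph k
    c = col ∘ name

    Geodesic : Name → Name → Set
    Geodesic x y = RainbowGeodesic c (code x) (code y)

    Path : Name → Name → Set
    Path x y = RainbowPath c (code x) (code y)

    HW : ∀ i → Geodesic H (W i)
    HW i = geodesicOf col (H ∷[ refl ] ⟦ W i ⟧) (distinct₂ (λ ())) (far-1 (λ ())) []

    HF : ∀ i → Geodesic H (F i)
    HF i = geodesicOf col (H ∷[ refl ] W i ∷[ W~F i ] ⟦ F i ⟧)
             (distinct₃ (λ ()) (λ ()) (λ ())) (far-2 (λ ()) (λ ())) ([] ∷ [])

    HY : ∀ j → Geodesic H (Y j)
    HY j = geodesicOf col (H ∷[ refl ] ⟦ Y j ⟧) (distinct₂ (λ ())) (far-1 (λ ())) []

    HS : ∀ j → Geodesic H (S j)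
    HS j = geodesicOf col (H ∷[ refl ] ⟦ S j ⟧) (distinct₂ (λ ())) (far-1 (λ ())) []

    HL : ∀ j → Geodesic H (L j)
    HL j = geodesicOf col (H ∷[ refl ] S j ∷[ S~L j ] ⟦ L j ⟧)
             (distinct₃ (λ ()) (λ ()) (λ ())) (far-2 (λ ()) (λ ())) ([] ∷ [])

    WW : ∀ i i′ → Geodesic (W i) (W i′)
    WW i i′ with i ≟ i′
    ... | yes refl = geodesic-self col (W i)
    ... | no i≢i′  = geodesicOf col (W i ∷[ refl ] H ∷[ refl ] ⟦ W i′ ⟧)
                       (distinct₃ (λ ()) (W≢ i≢i′) (λ ())) (far-2 (W≢ i≢i′) (λ ())) ([] ∷ [])

    WF : ∀ i i′ → Geodesic (W i) (F i′)
    WF i i′ with i ≟ i′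
    ... | yes refl = geodesicOf col (W i ∷[ W~F i ] ⟦ F i ⟧) (distinct₂ (λ ())) (far-1 (λ ())) []
    ... | no i≢i′  = geodesicOf col (W i ∷[ refl ] H ∷[ refl ] W i′ ∷[ W~F i′ ] ⟦ F i′ ⟧)
                       (distinct₄ (λ ()) (W≢ i≢i′) (λ ()) (λ ()) (λ ()) (λ ())) (far-WF i≢i′)
                       (distinct₂ (≢-sym (W≉H i′)))

    WY : ∀ i j → Geodesic (W i) (Y j)
    WY i j = geodesicOf col (W i ∷[ refl ] H ∷[ refl ] ⟦ Y j ⟧)
               (distinct₃ (λ ()) (λ ()) (λ ())) (far-2 (λ ()) (λ ())) ([] ∷ [])

    WS : ∀ i j → Geodesic (W i) (S j)
    WS i j = geodesicOf col (W i ∷[ refl ] H ∷[ refl ] ⟦ S j ⟧)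
               (distinct₃ (λ ()) (λ ()) (λ ())) (far-2 (λ ()) (λ ())) ([] ∷ [])

    WL : ∀ i j → Geodesic (W i) (L j)
    WL i j = geodesicOf col (W i ∷[ refl ] H ∷[ refl ] S j ∷[ S~L j ] ⟦ L j ⟧)
               (distinct₄ (λ ()) (λ ()) (λ ()) (λ ()) (λ ()) (λ ())) far-WL (distinct₂ (≢-sym (S≉H j)))

    FF : ∀ i i′ → Geodesic (F i) (F i′)
    FF i i′ with i ≟ i′
    ... | yes refl = geodesic-self col (F i)
    ... | no i≢i′  = geodesicOf col (F i ∷[ F~W i ] W i ∷[ refl ] H ∷[ refl ] W i′ ∷[ W~F i′ ] ⟦ F i′ ⟧)
                       (distinct₅ (λ ()) (λ ()) (λ ()) (F≢ i≢i′) (λ ()) (W≢ i≢i′) (λ ()) (λ ()) (λ ()) (λ ()))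
                       (far-F (F≢ i≢i′) (far-WF i≢i′)) (distinct₃ (W≉H i) (W≉W i≢i′) (≢-sym (W≉H i′)))

    FY : ∀ i j → Geodesic (F i) (Y j)
    FY i j = geodesicOf col (F i ∷[ F~W i ] W i ∷[ refl ] H ∷[ refl ] ⟦ Y j ⟧)
               (distinct₄ (λ ()) (λ ()) (λ ()) (λ ()) (λ ()) (λ ()))
               (far-F (λ ()) (far-2 (λ ()) (λ ()))) (distinct₂ (W≉H i))

    FS : ∀ i j → Geodesic (F i) (S j)
    FS i j = geodesicOf col (F i ∷[ F~W i ] W i ∷[ refl ] H ∷[ refl ] ⟦ S j ⟧)
               (distinct₄ (λ ()) (λ ()) (λ ()) (λ ()) (λ ()) (λ ()))
               (far-F (λ ()) (far-2 (λ ()) (λ ()))) (distinct₂ (W≉H i))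

    YY : ∀ j j′ → Geodesic (Y j) (Y j′)
    YY j j′ with j ≟ j′
    ... | yes refl = geodesic-self col (Y j)
    ... | no j≢j′  = geodesicOf col (Y j ∷[ Y~Y j≢j′ ] ⟦ Y j′ ⟧) (distinct₂ (Y≢ j≢j′)) (far-1 (Y≢ j≢j′)) []

    YS : ∀ j j′ → Geodesic (Y j) (S j′)
    YS j j′ = geodesicOf col (Y j ∷[ refl ] H ∷[ refl ] ⟦ S j′ ⟧)
                (distinct₃ (λ ()) (λ ()) (λ ())) (far-2 (λ ()) (λ ())) ([] ∷ [])

    YL : ∀ j j′ → Geodesic (Y j) (L j′)
    YL j j′ with j ≟ j′
    ... | yes refl = geodesicOf col (Y j ∷[ Y~L j ] ⟦ L j ⟧) (distinct₂ (λ ())) (far-1 (λ ())) []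
    ... | no j≢j′  = geodesicOf col (Y j ∷[ Y~Y j≢j′ ] Y j′ ∷[ Y~L j′ ] ⟦ L j′ ⟧)
                       (distinct₃ (Y≢ j≢j′) (λ ()) (λ ())) (far-2 (λ ()) (j≢j′ ∘ ==-sound ∘ ∨false)) ([] ∷ [])

    SS : ∀ j j′ → Geodesic (S j) (S j′)
    SS j j′ with j ≟ j′
    ... | yes refl = geodesic-self col (S j)
    ... | no j≢j′  = geodesicOf col (S j ∷[ refl ] H ∷[ refl ] ⟦ S j′ ⟧)
                       (distinct₃ (λ ()) (S≢ j≢j′) (λ ())) (far-2 (S≢ j≢j′) (λ ())) ([] ∷ [])

    SL : ∀ j j′ → Geodesic (S j) (L j′)
    SL j j′ with j ≟ j′
    ... | yes refl = geodesicOf col (S j ∷[ S~L j ] ⟦ L j ⟧) (distinct₂ (λ ())) (far-1 (λ ())) []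
    ... | no j≢j′  = geodesicOf col (S j ∷[ refl ] H ∷[ refl ] S j′ ∷[ S~L j′ ] ⟦ L j′ ⟧)
                       (distinct₄ (λ ()) (S≢ j≢j′) (λ ()) (λ ()) (λ ()) (λ ())) (far-SL j≢j′)
                       (distinct₂ (≢-sym (S≉H j′)))

    -- Every pair is related by a symmetric relation R containing the pairs
    -- with rainbow geodesics, provided R holds for the two remaining kinds of
    -- pairs (L j, L j′) and (F i, L j), whose treatment depends on the colouring.
    module _ {R : Name → Name → Set} (geodesic⇒R : ∀ {x y} → Geodesic x y → R x y)
             (R-sym : ∀ {x y} → R x y → R y x)
             (R-LL : ∀ {j j′} → j ≢ j′ → R (L j) (L j′)) (R-FL : ∀ i j → R (F i) (L j)) where

      everyPair : ∀ x y → R x y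
      everyPair H     H      = geodesic⇒R (geodesic-self col H)
      everyPair H     (W i)  = geodesic⇒R (HW i)
      everyPair H     (F i)  = geodesic⇒R (HF i)
      everyPair H     (Y j)  = geodesic⇒R (HY j)
      everyPair H     (S j)  = geodesic⇒R (HS j)
      everyPair H     (L j)  = geodesic⇒R (HL j)
      everyPair (W i) (W i′) = geodesic⇒R (WW i i′)
      everyPair (W i) (F i′) = geodesic⇒R (WF i i′)
      everyPair (W i) (Y j)  = geodesic⇒R (WY i j)
      everyPair (W i) (S j)  = geodesic⇒R (WS i j)
      everyPair (W i) (L j)  = geodesic⇒R (WL i j)
      everyPair (F i) (F i′) = geodesic⇒R (FF i i′)
      everyPair (F i) (Y j)  = geodesic⇒R (FY i j)
      everyPair (F i) (S j)  = geodesic⇒R (FS i j)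
      everyPair (F i) (L j)  = R-FL i j
      everyPair (Y j) (Y j′) = geodesic⇒R (YY j j′)
      everyPair (Y j) (S j′) = geodesic⇒R (YS j j′)
      everyPair (Y j) (L j′) = geodesic⇒R (YL j j′)
      everyPair (S j) (S j′) = geodesic⇒R (SS j j′)
      everyPair (S j) (L j′) = geodesic⇒R (SL j j′)
      everyPair (L j) (L j′) with j ≟ j′
      ... | yes refl  = geodesic⇒R (geodesic-self col (L j))
      ... | no j≢j′   = R-LL j≢j′
      everyPair (W i) H      = R-sym (everyPair H (W i))
      everyPair (F i) H      = R-sym (everyPair H (F i))
      everyPair (F i) (W i′) = R-sym (everyPair (W i′) (F i))
      everyPair (Y j) H      = R-sym (everyPair H (Y j))
      everyPair (Y j) (W i)  = R-sym (everyPair (W i) (Y j))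
      everyPair (Y j) (F i)  = R-sym (everyPair (F i) (Y j))
      everyPair (S j) H      = R-sym (everyPair H (S j))
      everyPair (S j) (W i)  = R-sym (everyPair (W i) (S j))
      everyPair (S j) (F i)  = R-sym (everyPair (F i) (S j))
      everyPair (S j) (Y j′) = R-sym (everyPair (Y j′) (S j))
      everyPair (L j) H      = R-sym (everyPair H (L j))
      everyPair (L j) (W i)  = R-sym (everyPair (W i) (L j))
      everyPair (L j) (F i)  = R-sym (everyPair (F i) (L j))
      everyPair (L j) (Y j′) = R-sym (everyPair (Y j′) (L j))
      everyPair (L j) (S j′) = R-sym (everyPair (S j′) (L j))

    -- If moreover the Y j have distinct colours and S j differs from every W i,
    -- the colouring is strongly rainbow: L j – Y j – Y j′ – L j′ and
    -- F i – W i – H – S j – L j are rainbow geodesics.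
    strongly : (∀ j j′ → j ≢ j′ → col (Y j) ≢ col (Y j′)) → (∀ i j → col (S j) ≢ col (W i)) →
               StronglyRainbowVC graph c
    strongly Y≉Y S≉W = allPairs (everyPair (λ g → g) (geodesic-sym c) LL FL)
      where
      LL : ∀ {j j′} → j ≢ j′ → Geodesic (L j) (L j′)
      LL {j} {j′} j≢j′ = geodesicOf col (L j ∷[ L~Y j ] Y j ∷[ Y~Y j≢j′ ] Y j′ ∷[ Y~L j′ ] ⟦ L j′ ⟧)
        (distinct₄ (λ ()) (λ ()) (L≢ j≢j′) (Y≢ j≢j′) (λ ()) (λ ())) (far-LL j≢j′) (distinct₂ (Y≉Y j j′ j≢j′))
      FL : ∀ i j → Geodesic (F i) (L j)
      FL i j = geodesicOf col (F i ∷[ F~W i ] W i ∷[ refl ] H ∷[ refl ] S j ∷[ S~L j ] ⟦ L j ⟧)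
        (distinct₅ (λ ()) (λ ()) (λ ()) (λ ()) (λ ()) (λ ()) (λ ()) (λ ()) (λ ()) (λ ()))
        (far-F (λ ()) far-WL) (distinct₃ (W≉H i) (≢-sym (S≉W i j)) (≢-sym (S≉H j)))

    rainbow : (∀ {j j′} → j ≢ j′ → Path (L j) (L j′)) → (∀ i j → Path (F i) (L j)) → RainbowVC graph c
    rainbow LL FL = allPairs (everyPair geodesic⇒path (path-sym c) LL FL)

  leg-route : ∀ {i i′ x y} → i ≢ i′ → x ≡ F i → y ≡ F i′ → (t : Trail x y) → Unique (verticesT t) →
              ∃ λ rest → innerT t ≡ W i ∷ rest × H ∈ rest × W i′ ∈ rest
  leg-route i≢i′ refl refl ⟦ _ ⟧ _ = ⊥-elim (i≢i′ refl)
  leg-route i≢i′ refl refl (_∷[_]_ {y = w} _ e t) distinct with nbr-F {z = w} e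
  leg-route {i} {i′} i≢i′ refl refl (_ ∷[ _ ] (_∷[_]_ {y = h} _ e₁ t₁)) distinct | refl with nbr-W {z = h} e₁
  ... | inj₂ refl = ⊥-elim (All.lookup (AllPairs.head distinct) (there (start∈verticesT t₁)) refl)
  ... | inj₁ refl = initT t₁ , refl , start∈initT (λ ()) t₁ , W′∈
    where
    W′∈ : W i′ ∈ initT t₁
    W′∈ with penultimate (λ ()) t₁
    ... | z , z~F , z∈ = subst (_∈ initT t₁) (nbr-F {z = z} (~-sym {z} {F i′} z~F)) z∈

  -- Any rainbow colouring gives H and all the W i pairwise distinct colours
  -- (each W i lies on a rainbow path between leg ends together with H and
  -- another W i′), so rvc ≥ q + 1 when there are at least two legs.
  legs-need-colours : (∀ i → ∃ λ i′ → i′ ≢ i) → ∀ k (cc : Colouring graph k) → RainbowVC graph cc → suc q ≤ k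
  legs-need-colours another k cc rainbowVC = injective⇒≤ {f = colour} colour-injective
    where
    col : Name → Fin k
    col = cc ∘ code

    apart : ∀ {i i′} → i ≢ i′ → col (W i) ≢ col H × col (W i) ≢ col (W i′)
    apart {i} {i′} i≢i′ with rainbowVC (code (F i)) (code (F i′))
    ... | p , isPath , rainbow
        with leg-route i≢i′ (name-code (F i)) (name-code (F i′)) (fromWalk p) (path-fromWalk p isPath)
    ...   | rest , inner≡ , H∈ , W′∈ = unique-head col {W i} {H} rainbow′ H∈ , unique-head col {W i} {W i′} rainbow′ W′∈
      where
      rainbow′ : Unique (map col (W i ∷ rest))
      rainbow′ = subst (Unique ∘ map col) inner≡ (rainbow-fromWalk cc p rainbow)

    W≉H : ∀ i → col (W i) ≢ col H
    W≉H i = proj₁ (apart (≢-sym (proj₂ (another i))))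

    colour : Fin (suc q) → Fin k
    colour zero    = col H
    colour (suc i) = col (W i)

    colour-injective : ∀ {a b} → colour a ≡ colour b → a ≡ b
    colour-injective {zero}  {zero}   _  = refl
    colour-injective {zero}  {suc i}  eq = ⊥-elim (W≉H i (≡-sym eq))
    colour-injective {suc i} {zero}   eq = ⊥-elim (W≉H i eq)
    colour-injective {suc i} {suc i′} eq with i ≟ i′
    ... | yes i≡i′ = cong suc i≡i′
    ... | no i≢i′  = ⊥-elim (proj₂ (apart i≢i′) eq)

  gadget-route : ∀ {j j′ x y} → x ≡ L j → y ≡ L j′ → (t : Trail x y) → lengthT t ≡ 3 →
                 innerT t ≡ Y j ∷ Y j′ ∷ []
  gadget-route {j′ = j′} refl refl (_∷[_]_ {y = a} _ e₀ (_∷[_]_ {y = b} _ e₁ (_ ∷[ e₂ ] ⟦ _ ⟧))) refl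
    with nbr-L {z = a} e₀ | nbr-L {z = b} (~-sym {b} {L j′} e₂)
  ... | inj₁ refl | inj₁ refl = refl
  ... | inj₁ refl | inj₂ refl = contradiction e₁ λ ()
  ... | inj₂ refl | inj₁ refl = contradiction e₁ λ ()
  ... | inj₂ refl | inj₂ refl = contradiction e₁ λ ()

  -- Any strongly rainbow colouring gives the Y j pairwise distinct colours:
  -- L j and L j′ are at distance 3 and every geodesic between them is
  -- L j – Y j – Y j′ – L j′.  So srvc ≥ m.
  gadgets-need-colours : ∀ k (cc : Colouring graph k) → StronglyRainbowVC graph cc → m ≤ k
  gadgets-need-colours k cc strongVC = injective⇒≤ {f = col ∘ Y} Y-injective
    where
    col : Name → Fin k
    col = cc ∘ code

    apart : ∀ {j j′} → j ≢ j′ → col (Y j) ≢ col (Y j′)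
    apart {j} {j′} j≢j′ with strongVC (code (L j)) (code (L j′))
    ... | p , (_ , shortest) , rainbow = unique-head col {Y j} {Y j′} rainbow′ (here refl)
      where
      direct : Trail (L j) (L j′)
      direct = L j ∷[ L~Y j ] Y j ∷[ Y~Y j≢j′ ] Y j′ ∷[ Y~L j′ ] ⟦ L j′ ⟧

      three : len p ≡ 3
      three = ≤-antisym
        (subst (len p ≤_) (len-toWalk direct)
          (shortest (toWalk direct)
            (toWalk-isPath direct (distinct₄ (λ ()) (λ ()) (L≢ j≢j′) (Y≢ j≢j′) (λ ()) (λ ())))))
        (farNames⇒≤len (far-LL j≢j′) p)

      rainbow′ : Unique (map col (Y j ∷ Y j′ ∷ []))
      rainbow′ = subst (Unique ∘ map col)
        (gadget-route (name-code (L j)) (name-code (L j′)) (fromWalk p) (trans (lengthT-fromWalk p) three))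
        (rainbow-fromWalk cc p rainbow)

    Y-injective : ∀ {j j′} → col (Y j) ≡ col (Y j′) → j ≡ j′
    Y-injective {j} {j′} eq with j ≟ j′
    ... | yes j≡j′ = j≡j′
    ... | no j≢j′  = ⊥-elim (apart j≢j′ eq)

another-leg : ∀ {q′} (i : Fin (suc (suc q′))) → ∃ λ i′ → i′ ≢ i
another-leg zero    = suc zero , λ ()
another-leg (suc _) = zero , λ ()

module EqualValues (q′ : ℕ) where

  q : ℕ
  q = suc (suc q′)

  open Family q 0

  colour : Name → Fin (suc q)
  colour H     = zero
  colour (W i) = suc i
  colour (F _) = zero
  colour (Y ())
  colour (S ())
  colour (L ())

  open Geodesics colour (λ _ ()) (λ i≢i′ eq → i≢i′ (suc-injective eq)) (λ ())

  values : Connected graph × RVC graph (suc q) × SRVC graph (suc q)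
  values = connected c (strong⇒rainbow c strongVC) (code H) ,
           equal-values (not-complete {H} {F zero} (λ ()) (λ ())) c strongVC (legs-need-colours another-leg)
    where
    strongVC : StronglyRainbowVC graph c
    strongVC = strongly (λ ()) (λ _ ())

module DistinctValues (q′ d : ℕ) where

  q : ℕ
  q = suc (suc q′)

  m : ℕ
  m = suc (suc q) + d

  open Family q m

  strongColour : Name → Fin m
  strongColour H     = zero
  strongColour (W i) = suc (suc (i ↑ˡ d))
  strongColour (F _) = zero
  strongColour (Y j) = j
  strongColour (S _) = suc zero
  strongColour (L _) = zero

  module Strong = Geodesics strongColour (λ _ ())
    (λ i≢i′ eq → i≢i′ (↑ˡ-injective d _ _ (suc-injective (suc-injective eq)))) (λ _ ())

  strongVC : StronglyRainbowVC graph Strong.c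
  strongVC = Strong.strongly (λ _ _ j≢j′ → j≢j′) (λ _ _ ())

  -- q + 1 colours, rainbow: the Y j all get colour 1 and the S j colour 2,
  -- which leaves a rainbow route through H between any L j and L j′, and
  -- between any F i and L j.
  pathColour : Name → Fin (suc q)
  pathColour H     = zero
  pathColour (W i) = suc i
  pathColour (F _) = zero
  pathColour (Y _) = 1F
  pathColour (S _) = 2F
  pathColour (L _) = zero

  module Paths = Geodesics pathColour (λ _ ()) (λ i≢i′ eq → i≢i′ (suc-injective eq)) (λ _ ())

  LL : ∀ {j j′} → j ≢ j′ → Paths.Path (L j) (L j′)
  LL {j} {j′} j≢j′ = pathOf pathColour (L j ∷[ L~Y j ] Y j ∷[ refl ] H ∷[ refl ] S j′ ∷[ S~L j′ ] ⟦ L j′ ⟧)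
    (distinct₅ (λ ()) (λ ()) (λ ()) (L≢ j≢j′) (λ ()) (λ ()) (λ ()) (λ ()) (λ ()) (λ ()))
    (distinct₃ (λ ()) (λ ()) (λ ()))

  FL : ∀ i j → Paths.Path (F i) (L j)
  FL zero j = pathOf pathColour (F zero ∷[ F~W zero ] W zero ∷[ refl ] H ∷[ refl ] S j ∷[ S~L j ] ⟦ L j ⟧)
    (distinct₅ (λ ()) (λ ()) (λ ()) (λ ()) (λ ()) (λ ()) (λ ()) (λ ()) (λ ()) (λ ()))
    (distinct₃ (λ ()) (λ ()) (λ ()))
  FL (suc i) j = pathOf pathColour (F (suc i) ∷[ F~W (suc i) ] W (suc i) ∷[ refl ] H ∷[ refl ] Y j ∷[ Y~L j ] ⟦ L j ⟧)
    (distinct₅ (λ ()) (λ ()) (λ ()) (λ ()) (λ ()) (λ ()) (λ ()) (λ ()) (λ ()) (λ ()))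
    (distinct₃ (λ ()) (λ ()) (λ ()))

  rainbowVC : RainbowVC graph Paths.c
  rainbowVC = Paths.rainbow LL FL

  values : Connected graph × RVC graph (suc q) × SRVC graph m
  values = connected Paths.c rainbowVC (code H) ,
           inj₂ (incomplete , (Paths.c , rainbowVC) , legs-need-colours another-leg) ,
           inj₂ (incomplete , (Strong.c , strongVC) , gadgets-need-colours)
    where
    incomplete : ¬ Complete graph
    incomplete = not-complete {H} {F zero} (λ ()) (λ ())

sufficiency : ∀ a b → (a ≡ b × (a ≡ 1 ⊎ a ≡ 2)) ⊎ (3 ≤ a × a ≤ b) →
              Σ Graph (λ G → Connected G × RVC G a × SRVC G b)
sufficiency _ _ (inj₁ (refl , inj₁ refl)) = Path3.graph , Path3.values
sufficiency _ _ (inj₁ (refl , inj₂ refl)) = Path4.graph , Path4.values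
sufficiency (suc (suc (suc q′))) b (inj₂ (s≤s (s≤s (s≤s _)) , a≤b)) with m≤n⇒m<n∨m≡n a≤b
... | inj₂ refl = Family.graph _ 0 , EqualValues.values q′
... | inj₁ a<b with m≤n⇒∃[o]m+o≡n a<b
...   | d , refl = Family.graph _ _ , DistinctValues.values q′ d

theorem4p6 : (a b : ℕ) → 1 ≤ a → 1 ≤ b →
    (Σ Graph (λ G → Connected G × RVC G a × SRVC G b))
      ⇔ ((a ≡ b × (a ≡ 1 ⊎ a ≡ 2)) ⊎ (3 ≤ a × a ≤ b))
theorem4p6 a b 1≤a 1≤b = mk⇔ (necessity 1≤a 1≤b) (sufficiency a b)
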